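{- Let $n \geq 1$. For every function $f : \{0,1\}^n \times \{0,1\}^n \to \{0,1\}$, we have $C^{\mathrm{comp}}(f) \leq 2n + 1$.
   Context: Order $\{0,1\}^n$ lexicographically, i.e. compare strings as binary representations of integers in $\{0,\dots,2^n-1\}$ with the first bit most significant. For $z \in \{0,1\}^n$, the comparison function $\theta_z : \{0,1\}^n \to \{0,1\}$ is defined by $\theta_z(y) = 1$ if and only if $y \geq z$. A comparison protocol is a rooted tree in which every internal vertex has exactly two children (via outgoing edges labeled $0$ and $1$), is owned either by Alice or by Bob, and is labeled by a function which is either some $\theta_z$ ($z \in \{0,1\}^n$) or the constant $0$ function; leaves are labeled by outputs in $\{0,1\}$. On input $(x,y)$ (Alice holds $x$, Bob holds $y$), one starts at the root; at an internal vertex owned by Alice (resp. Bob) its function is evaluated on $x$ (resp. $y$) and the edge labeled by the result is followed; the output is the label of the leaf reached. The protocol computes $f$ if this output equals $f(x,y)$ for all $(x,y)$. Its cost is its depth, the maximum number of edges on a root-to-leaf path. $C^{\mathrm{comp}}(f)$ is the minimum cost of a comparison protocol computing $f$. -}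

module Defs where

open import Data.Bool using (Bool; true; false; if_then_else_)
open import Data.Nat using (ℕ; zero; suc; _⊔_)
open import Data.Vec using (Vec; []; _∷_)
open import Data.Product using (Σ; _×_; _,_)
open import Relation.Binary.PropositionalEquality using (_≡_)
open import Data.Nat using (_≤_)

-- Bits: Bool with false = 0, true = 1.
-- Strings in {0,1}^n, first entry = most significant bit.
BitString : ℕ → Set
BitString n = Vec Bool n

_≥ᵇ_ : ∀ {n} → BitString n → BitString n → Bool
[] ≥ᵇ [] = true
(true ∷ y) ≥ᵇ (false ∷ z) = true
(false ∷ y) ≥ᵇ (true ∷ z) = false
(true ∷ y) ≥ᵇ (true ∷ z) = y ≥ᵇ z
(false ∷ y) ≥ᵇ (false ∷ z) = y ≥ᵇ z

θ : ∀ {n} → BitString n → BitString n → Bool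
θ z y = y ≥ᵇ z

data Player : Set where
  alice bob : Player

data Query (n : ℕ) : Set where
  cmp   : BitString n → Query n
  const0 : Query n

evalQuery : ∀ {n} → Query n → BitString n → Bool
evalQuery (cmp z) y = θ z y
evalQuery const0 y = false

data Protocol (n : ℕ) : Set where
  leaf : Bool → Protocol n
  node : Player → Query n → (child0 child1 : Protocol n) → Protocol n

depth : ∀ {n} → Protocol n → ℕ
depth (leaf _) = zero
depth (node _ _ c0 c1) = suc (depth c0 ⊔ depth c1)

run : ∀ {n} → Protocol n → BitString n → BitString n → Bool
run (leaf b) x y = b
run (node alice q c0 c1) x y = if evalQuery q x then run c1 x y else run c0 x y
run (node bob q c0 c1) x y = if evalQuery q y then run c1 x y else run c0 x y

Computes : ∀ {n} → Protocol n → (BitString n → BitString n → Bool) → Set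
Computes P f = ∀ x y → run P x y ≡ f x y

-- C^comp(f) ≤ k  iff some comparison protocol of cost ≤ k computes f.
CompCostAtMost : ∀ {n} → (BitString n → BitString n → Bool) → ℕ → Set
CompCostAtMost {n} f k = Σ (Protocol n) λ P → Computes P f × depth P ≤ k

{-# OPTIONS --safe #-}
-- Each player can announce their whole input with n comparison queries by
-- binary search: once a prefix u of x is known, θ applied to u·1·0…0 reveals
-- the next bit of x. Alice announces x, then Bob announces y, after which the
-- leaf can output f x y; the resulting tree has depth 2n.
module Submission where

open import Defs
open import Data.Bool using (Bool; true; false; if_then_else_)
open import Data.Nat using (ℕ; zero; suc; _+_; _*_; _≤_; z≤n; s≤s)
open import Data.Nat.Properties using (⊔-lub; ≤-trans; m≤m+n)
open import Data.Vec using (replicate; _∷_; [])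
open import Data.Product using (_,_)
open import Relation.Binary.PropositionalEquality using (_≡_; refl; trans)

zeros : ∀ n → BitString n
zeros n = replicate n false

≥ᵇ-zeros : ∀ {n} (v : BitString n) → v ≥ᵇ zeros n ≡ true
≥ᵇ-zeros []          = refl
≥ᵇ-zeros (true ∷ v)  = refl
≥ᵇ-zeros (false ∷ v) = ≥ᵇ-zeros v

≥ᵇ-leadingOne : ∀ {n} b (v : BitString n) → (b ∷ v) ≥ᵇ (true ∷ zeros n) ≡ b
≥ᵇ-leadingOne true  v = ≥ᵇ-zeros v
≥ᵇ-leadingOne false v = refl

OrderEmbedding : ∀ {k m} → (BitString k → BitString m) → Set
OrderEmbedding e = ∀ u v → e u ≥ᵇ e v ≡ u ≥ᵇ v

orderEmbedding-id : ∀ {n} → OrderEmbedding {n} (λ v → v)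
orderEmbedding-id u v = refl

orderEmbedding-fixHead : ∀ {k m} {e : BitString (suc k) → BitString m} →
  OrderEmbedding e → ∀ b → OrderEmbedding (λ v → e (b ∷ v))
orderEmbedding-fixHead emb true  u v = emb (true ∷ u) (true ∷ v)
orderEmbedding-fixHead emb false u v = emb (false ∷ u) (false ∷ v)

input : ∀ {m} → Player → BitString m → BitString m → BitString m
input alice x y = x
input bob   x y = y

run-node : ∀ {m} p (q : Query m) c₀ c₁ x y →
  run (node p q c₀ c₁) x y ≡ (if evalQuery q (input p x y) then run c₁ x y else run c₀ x y)
run-node alice q c₀ c₁ x y = refl
run-node bob   q c₀ c₁ x y = refl

-- Player p's input is known to lie in the image of the order embedding e;
-- the protocol finds its preimage v and continues with k v.
reveal : ∀ {m} → Player → ∀ k → (BitString k → BitString m) →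
  (BitString k → Protocol m) → Protocol m
reveal p zero    e cont = cont []
reveal p (suc k) e cont = node p (cmp (e (true ∷ zeros k)))
  (reveal p k (λ v → e (false ∷ v)) (λ v → cont (false ∷ v)))
  (reveal p k (λ v → e (true ∷ v))  (λ v → cont (true ∷ v)))

run-reveal : ∀ {k m} p (e : BitString k → BitString m) cont → OrderEmbedding e →
  ∀ v x y → input p x y ≡ e v → run (reveal p k e cont) x y ≡ run (cont v) x y
run-reveal p e cont emb [] x y _ = refl
run-reveal {suc k} p e cont emb (b ∷ v) x y input≡ev
  rewrite run-node p (cmp (e (true ∷ zeros k)))
            (reveal p k (λ v → e (false ∷ v)) (λ v → cont (false ∷ v)))
            (reveal p k (λ v → e (true ∷ v))  (λ v → cont (true ∷ v))) x y
        | input≡ev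
        | emb (b ∷ v) (true ∷ zeros k)
        | ≥ᵇ-leadingOne b v
        = next b input≡ev
  where
  next : ∀ c → input p x y ≡ e (c ∷ v) →
         (if c then run (reveal p k (λ v → e (true ∷ v)) (λ v → cont (true ∷ v))) x y
               else run (reveal p k (λ v → e (false ∷ v)) (λ v → cont (false ∷ v))) x y)
         ≡ run (cont (c ∷ v)) x y
  next true  = run-reveal p _ _ (orderEmbedding-fixHead {e = e} emb true)  v x y
  next false = run-reveal p _ _ (orderEmbedding-fixHead {e = e} emb false) v x y

depth-reveal : ∀ {m} p k (e : BitString k → BitString m) cont d →
  (∀ v → depth (cont v) ≤ d) → depth (reveal p k e cont) ≤ k + d
depth-reveal p zero    e cont d bound = bound []
depth-reveal p (suc k) e cont d bound = s≤s (⊔-lub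
  (depth-reveal p k _ _ d (λ v → bound (false ∷ v)))
  (depth-reveal p k _ _ d (λ v → bound (true ∷ v))))

revealBoth : ∀ {n} → (BitString n → BitString n → Bool) → Protocol n
revealBoth {n} f =
  reveal alice n (λ v → v) λ x → reveal bob n (λ v → v) λ y → leaf (f x y)

revealBoth-computes : ∀ {n} (f : BitString n → BitString n → Bool) → Computes (revealBoth f) f
revealBoth-computes {n} f x y = trans
  (run-reveal alice _ _ orderEmbedding-id x x y refl)
  (run-reveal bob _ (λ y → leaf (f x y)) orderEmbedding-id y x y refl)

depth-revealBoth : ∀ {n} (f : BitString n → BitString n → Bool) → depth (revealBoth f) ≤ 2 * n
depth-revealBoth {n} f =
  depth-reveal alice n _ _ (n + 0) λ x → depth-reveal bob n _ _ 0 λ y → z≤n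

mainTheorem4 : (n : ℕ) → 1 ≤ n → (f : BitString n → BitString n → Bool) → CompCostAtMost f (2 * n + 1)
mainTheorem4 n _ f =
  revealBoth f , revealBoth-computes f , ≤-trans (depth-revealBoth f) (m≤m+n (2 * n) 1)
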